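{- Let $D=(V,A)$ be a digraph and $\mathcal{L}\subseteq 2^V$ a laminar family with $V\in\mathcal{L}$. Suppose that for every $F\in\mathcal{L}$ and every pair of non-empty disjoint sets $Z_1,Z_2\subseteq F$ we have $f_{D[F],\mathcal{L}[F]}(Z_1)+f_{D[F],\mathcal{L}[F]}(Z_2)\ge 1$. Then $D$ contains an $\mathcal{L}$-tight arborescence.
   Context: A (spanning) arborescence of $D=(V,A)$ is a set $B\subseteq A$ which is a spanning tree in the undirected sense and in which every node has in-degree at most one; the node of in-degree $0$ is its root. For a laminar family $\mathcal{L}\subseteq 2^V$, a spanning arborescence $B$ is $\mathcal{L}$-tight if $|\delta^{in}_B(F)|\le 1$ for all $F\in\mathcal{L}$, and $|\delta^{in}_B(F)|=0$ for all $F\in\mathcal{L}$ containing the root of $B$. $D[F]$ is the subdigraph induced by $F$, $\mathcal{L}[F]=\{F'\in\mathcal{L}:F'\subseteq F\}$. For $Z\subseteq V$, $\mathcal{L}_Z=\{F\in\mathcal{L}: F\cap Z\ne\emptyset\}$, $M_{D,\mathcal{L}}(Z)=\delta^{in}_D(Z)\setminus\bigcup_{F\in\mathcal{L}_Z}\delta^{out}_D(F)$ and $f_{D,\mathcal{L}}(Z)=|M_{D,\mathcal{L}}(Z)|$. -}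

module Defs where

open import Data.Nat using (ℕ; suc; _+_; _≤_; _≥_; _∸_)
open import Data.Bool using (Bool; true; false; _∧_; not)
open import Data.Fin using (Fin)
open import Data.Product using (_×_; _,_; proj₁; proj₂; Σ; ∃)
open import Data.Sum using (_⊎_)
open import Data.List using (List; map; filter)
open import Data.List.Membership.Propositional using () renaming (_∈_ to _∈ₗ_)
open import Data.Vec using (lookup; tabulate)
open import Data.Fin.Subset using (Subset; _∈_; _∉_; _⊆_; _∩_; _∪_; _─_; ⊥; ⊤; ⋃; ∣_∣; Nonempty)
open import Data.Fin.Subset.Properties using (_⊆?_; nonempty?)
open import Relation.Binary.PropositionalEquality using (_≡_)
open import Relation.Nullary.Decidable using (_×-dec_)

-- A digraph D = (V, A) has vertex set V = Fin n and a finite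
-- family of arcs indexed by Fin m (parallel arcs and loops allowed);
-- arc a goes from  tail D a  to  head D a.

record Digraph (n : ℕ) : Set where
  field
    m   : ℕ
    arc : Fin m → Fin n × Fin n

  tail : Fin m → Fin n
  tail a = proj₁ (arc a)

  head : Fin m → Fin n
  head a = proj₂ (arc a)

open Digraph public

-- Cuts inside the induced subdigraph D[W] (W ⊆ V).  An arc belongs to
-- D[W] iff both of its ends lie in W.  For W = ⊤ these are the usual
-- cuts of D.

δin : ∀ {n} (D : Digraph n) → Subset n → Subset n → Subset (m D)
δin D W Z = tabulate λ a →
  lookup Z (head D a) ∧ lookup W (tail D a) ∧ not (lookup Z (tail D a))

δout : ∀ {n} (D : Digraph n) → Subset n → Subset n → Subset (m D)
δout D W F = tabulate λ a →
  lookup F (tail D a) ∧ lookup W (head D a) ∧ not (lookup F (head D a))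

Laminar : ∀ {n} → List (Subset n) → Set
Laminar L = ∀ {X Y} → X ∈ₗ L → Y ∈ₗ L → X ⊆ Y ⊎ Y ⊆ X ⊎ X ∩ Y ≡ ⊥

-- M_{D[W],L[W]}(Z) and f_{D[W],L[W]}(Z).
-- L[W] = members of L contained in W; (L[W])_Z = those also meeting Z.

LZ : ∀ {n} → List (Subset n) → Subset n → Subset n → List (Subset n)
LZ L W Z = filter (λ F → (F ⊆? W) ×-dec nonempty? (F ∩ Z)) L

M : ∀ {n} (D : Digraph n) (L : List (Subset n)) (W Z : Subset n) → Subset (m D)
M D L W Z = δin D W Z ─ ⋃ (map (δout D W) (LZ L W Z))

f : ∀ {n} (D : Digraph n) (L : List (Subset n)) (W Z : Subset n) → ℕ
f D L W Z = ∣ M D L W Z ∣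

data Connected {n} (D : Digraph n) (B : Subset (m D)) : Fin n → Fin n → Set where
  here : ∀ {u} → Connected D B u u
  fwd  : ∀ {u} a → a ∈ B → Connected D B (head D a) u → Connected D B (tail D a) u
  bwd  : ∀ {u} a → a ∈ B → Connected D B (tail D a) u → Connected D B (head D a) u

-- in the undirected sense: connected on all of V, and acyclic
-- (no arc of B lies on a cycle, i.e. its ends are not connected by B ∖ {a};
-- in particular B has no loops)
IsSpanningTree : ∀ {n} (D : Digraph n) → Subset (m D) → Set
IsSpanningTree D B =
  (∀ u v → Connected D B u v) ×
  (∀ a → a ∈ B → Connected D (B Data.Fin.Subset.- a) (tail D a) (head D a) → Data.Empty.⊥)
  where import Data.Fin.Subset ; import Data.Empty

indeg : ∀ {n} (D : Digraph n) → Subset (m D) → Fin n → ℕ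
indeg D B v = ∣ B ∩ δin D ⊤ (Data.Fin.Subset.⁅ v ⁆) ∣
  where import Data.Fin.Subset

IsArborescence : ∀ {n} (D : Digraph n) → Subset (m D) → Set
IsArborescence D B = IsSpanningTree D B × (∀ v → indeg D B v ≤ 1)

IsRoot : ∀ {n} (D : Digraph n) → Subset (m D) → Fin n → Set
IsRoot D B r = indeg D B r ≡ 0

IsTight : ∀ {n} (D : Digraph n) (L : List (Subset n)) → Subset (m D) → Set
IsTight D L B =
  IsArborescence D B ×
  (∀ {F} → F ∈ₗ L → ∣ B ∩ δin D ⊤ F ∣ ≤ 1) ×
  (∀ {F} r → F ∈ₗ L → IsRoot D B r → r ∈ F → ∣ B ∩ δin D ⊤ F ∣ ≡ 0)

-- Proof by induction over L, from small members to large.  For each F ∈ L we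
-- find a nonempty R ⊆ F with f_{D[F],L[F]}(R) = 0 every vertex of which roots an
-- L[F]-tight arborescence of D[F].  The children of F (its maximal proper members
-- in L, and the singletons they miss) partition F, and each child C has such a
-- root set R_C by induction.  Call Z admissible if it is a union of sets R_C;
-- admissible sets with f = 0 are closed under intersection.  Starting from the
-- union of all R_C, try to grow an arborescence from r ∈ Z: enter a new child C
-- by an arc into R_C and hang the tree of C rooted at its head.  If this gets
-- stuck on X ≠ F, the union Z′ of the R_C for children C outside X is admissible,
-- has f(Z′) = 0 and misses r; by the hypothesis Z and Z′ meet, so Z ∩ Z′ is a
-- smaller admissible set with f = 0, and we start again from it.

module Submission where

open import Defs
open import Level using (0ℓ)
open import Function using (_∘_; case_of_; Equivalence)
open import Data.Empty using (⊥-elim)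
import Data.Bool as Bool
open import Data.Nat using (ℕ; zero; suc; _≤_; _<_; _+_; _∸_; _≥_; z≤n; s≤s; _<?_)
open import Data.Nat.Properties
  using (≤-refl; <⇒≤; ≤-<-trans; <-≤-trans; n≮n; m≤m+n; +-monoʳ-<; ∸-monoʳ-<)
open import Data.Nat.Induction using (<-wellFounded)
open import Induction.WellFounded using (Acc; acc)
open import Data.Bool using (Bool; true; false; _∧_; not)
open import Data.Product using (_×_; Σ; Σ-syntax; ∃; _,_; proj₁; proj₂)
open import Data.Sum using (_⊎_; inj₁; inj₂; map₁)
open import Data.Fin using (Fin; zero; suc; _≟_)
open import Data.Fin.Properties using (any?)
open import Data.Vec using ([]; _∷_; here; there; tabulate; lookup)
open import Data.Vec.Properties using ([]=⇒lookup; lookup⇒[]=; lookup∘tabulate; ≡-dec)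
open import Data.List using (List; []; _∷_; foldr)
open import Data.List.Relation.Unary.Any using () renaming (here to hereₗ; there to thereₗ)
open import Data.List.Membership.Propositional using () renaming (_∈_ to _∈ₗ_)
open import Data.List.Membership.Propositional.Properties using (∈-filter⁺; ∈-map⁺)
open import Data.Fin.Subset
  using (Subset; _∈_; _∉_; _⊆_; _⊂_; _∩_; _∪_; _─_; _-_; ⊥; ⊤; ⁅_⁆; ⋃; ∣_∣; Nonempty; Empty)
open import Data.Fin.Subset.Properties
  using (_∈?_; _⊆?_; _⊂?_; nonempty?; ∈⊤; ∉⊥; x∈⁅x⁆; x∈⁅y⁆⇒x≡y; x∈⁅y⁆⇔x≡y; ∣⁅x⁆∣≡1; ∣⊥∣≡0;
         Empty-unique; ⊆-antisym; p∩q⊆p; p⊆q⇒∣p∣≤∣q∣; p⊂q⇒∣p∣<∣q∣; p─q⊆p; x∈p∩q⁺; x∈p∩q⁻; x∈p∪q⁺; x∈p∪q⁻)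
open import Relation.Unary using (Pred; Decidable)
open import Relation.Nullary using (¬_; yes; no; does; ¬?)
open import Relation.Nullary.Decidable using (_×-dec_; dec-true)
open import Relation.Binary.PropositionalEquality
  using (_≡_; _≢_; refl; sym; trans; cong; cong₂; subst; subst₂)

x∈p─q⇒x∉q : ∀ {k} (p q : Subset k) {x} → x ∈ p ─ q → x ∉ q
x∈p─q⇒x∉q (_ ∷ p) (true  ∷ q) {zero}  ()
x∈p─q⇒x∉q (_ ∷ p) (false ∷ q) {zero}  _ ()
x∈p─q⇒x∉q (_ ∷ p) (_     ∷ q) {suc x} (there x∈) (there x∈q) = x∈p─q⇒x∉q p q x∈ x∈q

pointwise⊎⇒⊎ : ∀ {k} {P : Fin k → Set} {Q : Set} → (∀ i → P i ⊎ Q) → (∀ i → P i) ⊎ Q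
pointwise⊎⇒⊎ {zero}  _ = inj₁ λ ()
pointwise⊎⇒⊎ {suc k} h with h zero | pointwise⊎⇒⊎ (h ∘ suc)
... | inj₂ q  | _        = inj₂ q
... | inj₁ _  | inj₂ q   = inj₂ q
... | inj₁ p₀ | inj₁ pₛ = inj₁ λ { zero → p₀ ; (suc i) → pₛ i }

module _ {k : ℕ} where

  ⟦_⟧ : {P : Pred (Fin k) 0ℓ} → Decidable P → Subset k
  ⟦ P? ⟧ = tabulate (does ∘ P?)

  ∈-tabulate⁻ : ∀ {f : Fin k → Bool} {x} → x ∈ tabulate f → f x ≡ true
  ∈-tabulate⁻ {f} {x} x∈ = trans (sym (lookup∘tabulate f x)) ([]=⇒lookup x∈)

  ∈-tabulate⁺ : ∀ {f : Fin k → Bool} {x} → f x ≡ true → x ∈ tabulate f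
  ∈-tabulate⁺ {f} {x} fx = lookup⇒[]= x _ (trans (lookup∘tabulate f x) fx)

  ∈⟦⟧⁻ : {P : Pred (Fin k) 0ℓ} (P? : Decidable P) {x : Fin k} → x ∈ ⟦ P? ⟧ → P x
  ∈⟦⟧⁻ P? {x} x∈ with P? x | ∈-tabulate⁻ {does ∘ P?} x∈
  ... | yes p | _ = p

  ∈⟦⟧⁺ : {P : Pred (Fin k) 0ℓ} (P? : Decidable P) {x : Fin k} → P x → x ∈ ⟦ P? ⟧
  ∈⟦⟧⁺ P? {x} p = ∈-tabulate⁺ (dec-true (P? x) p)

  lookup≡false⇒∉ : ∀ {p : Subset k} {x} → lookup p x ≡ false → x ∉ p
  lookup≡false⇒∉ px≡false x∈p with () ← trans (sym ([]=⇒lookup x∈p)) px≡false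

  ∉⇒lookup≡false : ∀ {p : Subset k} {x} → x ∉ p → lookup p x ≡ false
  ∉⇒lookup≡false {p} {x} x∉p with lookup p x in px
  ... | true  = ⊥-elim (x∉p (lookup⇒[]= x p px))
  ... | false = refl

  Empty⇒∣p∣≡0 : {p : Subset k} → Empty p → ∣ p ∣ ≡ 0
  Empty⇒∣p∣≡0 ∅ = trans (cong ∣_∣ (Empty-unique ∅)) (∣⊥∣≡0 k)

  x∈p⇒∣p∣≢0 : {p : Subset k} {x : Fin k} → x ∈ p → ∣ p ∣ ≢ 0
  x∈p⇒∣p∣≢0 {p} {x} x∈p ∣p∣≡0 with () ←
    subst₂ _≤_ (∣⁅x⁆∣≡1 x) ∣p∣≡0 (p⊆q⇒∣p∣≤∣q∣ λ y∈ → subst (_∈ p) (sym (x∈⁅y⁆⇒x≡y x y∈)) x∈p)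

  ∣p∣≤1 : (p : Subset k) → (∀ {x y} → x ∈ p → y ∈ p → x ≡ y) → ∣ p ∣ ≤ 1
  ∣p∣≤1 p unique with nonempty? p
  ... | no ∅ = subst (_≤ 1) (sym (Empty⇒∣p∣≡0 ∅)) z≤n
  ... | yes (x , x∈p) = subst (∣ p ∣ ≤_) (∣⁅x⁆∣≡1 x)
    (p⊆q⇒∣p∣≤∣q∣ λ y∈p → Equivalence.from x∈⁅y⁆⇔x≡y (unique y∈p x∈p))

  ⊈⇒∃∉ : {p q : Subset k} → ¬ p ⊆ q → ∃ λ x → x ∈ p × x ∉ q
  ⊈⇒∃∉ {p} {q} p⊈q with any? (λ x → (x ∈? p) ×-dec ¬? (x ∈? q))
  ... | yes w = w
  ... | no ∄ = ⊥-elim (p⊈q p⊆q)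
    where
    p⊆q : p ⊆ q
    p⊆q {x} x∈p with x ∈? q
    ... | yes x∈q = x∈q
    ... | no  x∉q = ⊥-elim (∄ (x , x∈p , x∉q))

  x∈⋃⁺ : ∀ {xs : List (Subset k)} {S x} → S ∈ₗ xs → x ∈ S → x ∈ ⋃ xs
  x∈⋃⁺ (hereₗ refl) x∈S = x∈p∪q⁺ (inj₁ x∈S)
  x∈⋃⁺ (thereₗ S∈) x∈S = x∈p∪q⁺ (inj₂ (x∈⋃⁺ S∈ x∈S))

∧-∧-not⁻ : ∀ {x y z} → x ∧ y ∧ not z ≡ true → x ≡ true × y ≡ true × z ≡ false
∧-∧-not⁻ {true}  {true}  {false} refl = refl , refl , refl
∧-∧-not⁻ {true}  {true}  {true}  ()
∧-∧-not⁻ {true}  {false} ()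
∧-∧-not⁻ {false} ()

∧-∧-not⁺ : ∀ {x y z} → x ≡ true → y ≡ true → z ≡ false → x ∧ y ∧ not z ≡ true
∧-∧-not⁺ refl refl refl = refl

module _ {n} (D : Digraph n) where

  ∈δin⁻ : ∀ {W Z a} → a ∈ δin D W Z → head D a ∈ Z × tail D a ∈ W × tail D a ∉ Z
  ∈δin⁻ {W} {Z} a∈ with ∧-∧-not⁻ (∈-tabulate⁻ a∈)
  ... | h∈Z , t∈W , t∉Z = lookup⇒[]= _ Z h∈Z , lookup⇒[]= _ W t∈W , lookup≡false⇒∉ t∉Z

  ∈δin⁺ : ∀ {W Z a} → head D a ∈ Z → tail D a ∈ W → tail D a ∉ Z → a ∈ δin D W Z
  ∈δin⁺ h∈Z t∈W t∉Z = ∈-tabulate⁺ (∧-∧-not⁺ ([]=⇒lookup h∈Z) ([]=⇒lookup t∈W) (∉⇒lookup≡false t∉Z))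

  ∈δout⁻ : ∀ {W Z a} → a ∈ δout D W Z → tail D a ∈ Z × head D a ∈ W × head D a ∉ Z
  ∈δout⁻ {W} {Z} a∈ with ∧-∧-not⁻ (∈-tabulate⁻ a∈)
  ... | t∈Z , h∈W , h∉Z = lookup⇒[]= _ Z t∈Z , lookup⇒[]= _ W h∈W , lookup≡false⇒∉ h∉Z

  ∈δout⁺ : ∀ {W Z a} → tail D a ∈ Z → head D a ∈ W → head D a ∉ Z → a ∈ δout D W Z
  ∈δout⁺ t∈Z h∈W h∉Z = ∈-tabulate⁺ (∧-∧-not⁺ ([]=⇒lookup t∈Z) ([]=⇒lookup h∈W) (∉⇒lookup≡false h∉Z))

  Connected-trans : ∀ {B x y z} → Connected D B x y → Connected D B y z → Connected D B x z
  Connected-trans here         q = q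
  Connected-trans (fwd a a∈ p) q = fwd a a∈ (Connected-trans p q)
  Connected-trans (bwd a a∈ p) q = bwd a a∈ (Connected-trans p q)

  Connected-sym : ∀ {B x y} → Connected D B x y → Connected D B y x
  Connected-sym here         = here
  Connected-sym (fwd a a∈ p) = Connected-trans (Connected-sym p) (bwd a a∈ here)
  Connected-sym (bwd a a∈ p) = Connected-trans (Connected-sym p) (fwd a a∈ here)

  Connected-transport : ∀ {B} (Q : Pred (Fin n) 0ℓ) →
    (∀ {a} → a ∈ B → Q (head D a) → Q (tail D a)) →
    (∀ {a} → a ∈ B → Q (tail D a) → Q (head D a)) →
    ∀ {x y} → Connected D B x y → Q y → Q x
  Connected-transport Q back forth here         qy = qy
  Connected-transport Q back forth (fwd a a∈ p) qy = back  a∈ (Connected-transport Q back forth p qy)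
  Connected-transport Q back forth (bwd a a∈ p) qy = forth a∈ (Connected-transport Q back forth p qy)

  Entry : Fin n → (Fin n → Fin (m D)) → Subset n → Pred (Fin n) 0ℓ
  Entry r parent G v = v ∈ G × v ≢ r × tail D (parent v) ∉ G

  -- For the arborescence formed by the parent arcs: |δ^in(G)| ≤ 1, and = 0 if r ∈ G.
  TightAt : Fin n → (Fin n → Fin (m D)) → Subset n → Set
  TightAt r parent G = ∀ {v} → Entry r parent G v → r ∉ G × (∀ {w} → Entry r parent G w → v ≡ w)

  module ParentTree (L : List (Subset n)) (r : Fin n)
    (parent : Fin n → Fin (m D)) (rank : Fin n → ℕ)
    (parent-enters  : ∀ {v} → v ≢ r → head D (parent v) ≡ v)
    (rank-decreases : ∀ {v} → v ≢ r → rank (tail D (parent v)) < rank v)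
    (tight          : ∀ {G} → G ∈ₗ L → TightAt r parent G) where

    IsTreeArc : Pred (Fin (m D)) 0ℓ
    IsTreeArc a = a ≡ parent (head D a) × head D a ≢ r

    tree-arc? : Decidable IsTreeArc
    tree-arc? a = (a ≟ parent (head D a)) ×-dec ¬? (head D a ≟ r)

    arcs : Subset (m D)
    arcs = ⟦ tree-arc? ⟧

    ∈arcs⁻ : ∀ {a} → a ∈ arcs → IsTreeArc a
    ∈arcs⁻ = ∈⟦⟧⁻ tree-arc?

    parent∈arcs : ∀ {v} → v ≢ r → parent v ∈ arcs
    parent∈arcs {v} v≢r = ∈⟦⟧⁺ tree-arc?
      ( cong parent (sym (parent-enters v≢r))
      , λ h≡r → v≢r (trans (sym (parent-enters v≢r)) h≡r))

    reaches-root : ∀ {v} → Acc _<_ (rank v) → Connected D arcs v r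
    reaches-root {v} (acc rs) with v ≟ r
    ... | yes refl = here
    ... | no  v≢r  = subst (λ x → Connected D arcs x r) (parent-enters v≢r)
      (bwd (parent v) (parent∈arcs v≢r) (reaches-root (rs (rank-decreases v≢r))))

    connected : ∀ u v → Connected D arcs u v
    connected u v = Connected-trans (reaches-root (<-wellFounded _))
                                    (Connected-sym (reaches-root (<-wellFounded _)))

    data Descendant (h : Fin n) : Fin n → Set where
      self  : ∀ {x} → x ≡ h → Descendant h x
      up    : ∀ {x} → x ≢ r → Descendant h (tail D (parent x)) → Descendant h x

    descendant-rank : ∀ {h x} → Descendant h x → rank h ≤ rank x
    descendant-rank (self refl)   = ≤-refl
    descendant-rank (up x≢r d)    = <⇒≤ (≤-<-trans (descendant-rank d) (rank-decreases x≢r))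

    -- Off the arc a, being a descendant of head a is invariant along tree arcs;
    -- yet tail a, the parent of head a, has smaller rank.
    acyclic : ∀ a → a ∈ arcs → ¬ Connected D (arcs - a) (tail D a) (head D a)
    acyclic a a∈ path = n≮n _ (≤-<-trans (descendant-rank tail-descendant) tail-rank)
      where
      h = head D a
      a-tree = ∈arcs⁻ a∈
      tail-rank : rank (tail D a) < rank h
      tail-rank = subst (λ b → rank (tail D b) < rank h) (sym (proj₁ a-tree)) (rank-decreases (proj₂ a-tree))
      other-tree-arc : ∀ {b} → b ∈ arcs - a → IsTreeArc b × b ≢ a
      other-tree-arc {b} b∈ = ∈arcs⁻ (p─q⊆p arcs ⁅ a ⁆ b∈)
                            , λ b≡a → x∈p─q⇒x∉q arcs ⁅ a ⁆ b∈ (subst (_∈ ⁅ a ⁆) (sym b≡a) (x∈⁅x⁆ a))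
      back : ∀ {b} → b ∈ arcs - a → Descendant h (head D b) → Descendant h (tail D b)
      back b∈ (self hb≡h) with other-tree-arc b∈
      ... | (b≡par , _) , b≢a = ⊥-elim (b≢a (trans b≡par (trans (cong parent hb≡h) (sym (proj₁ a-tree)))))
      back b∈ (up _ d) with other-tree-arc b∈
      ... | (b≡par , _) , _ = subst (λ c → Descendant h (tail D c)) (sym b≡par) d
      forth : ∀ {b} → b ∈ arcs - a → Descendant h (tail D b) → Descendant h (head D b)
      forth b∈ d with other-tree-arc b∈
      ... | (b≡par , hb≢r) , _ = up hb≢r (subst (λ c → Descendant h (tail D c)) b≡par d)
      tail-descendant : Descendant h (tail D a)
      tail-descendant = Connected-transport (Descendant h) back forth path (self refl)

    ∈arcs∩δin⁻ : ∀ {G a} → a ∈ arcs ∩ δin D ⊤ G → a ≡ parent (head D a) × Entry r parent G (head D a)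
    ∈arcs∩δin⁻ {G} a∈ with x∈p∩q⁻ arcs _ a∈
    ... | a∈arcs , a∈δin with ∈arcs⁻ a∈arcs | ∈δin⁻ {⊤} {G} a∈δin
    ... | a≡par , h≢r | h∈G , _ , t∉G = a≡par , h∈G , h≢r , subst (λ b → tail D b ∉ G) a≡par t∉G

    ∣entering∣≤1 : ∀ {G} → (∀ {v w} → Entry r parent G v → Entry r parent G w → v ≡ w) →
                  ∣ arcs ∩ δin D ⊤ G ∣ ≤ 1
    ∣entering∣≤1 unique = ∣p∣≤1 _ λ a∈ b∈ →
      let a≡par , ea = ∈arcs∩δin⁻ a∈
          b≡par , eb = ∈arcs∩δin⁻ b∈
      in trans a≡par (trans (cong parent (unique ea eb)) (sym b≡par))

    indegree≤1 : ∀ v → indeg D arcs v ≤ 1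
    indegree≤1 v = ∣entering∣≤1 λ (v'∈ , _) (w∈ , _) → trans (x∈⁅y⁆⇒x≡y v v'∈) (sym (x∈⁅y⁆⇒x≡y v w∈))

    root-unique : ∀ {r'} → IsRoot D arcs r' → r' ≡ r
    root-unique {r'} indeg≡0 with r' ≟ r
    ... | yes r'≡r = r'≡r
    ... | no  r'≢r = ⊥-elim (x∈p⇒∣p∣≢0 (x∈p∩q⁺ (parent∈arcs r'≢r , parent-enters-r')) indeg≡0)
      where
      tail∉ : tail D (parent r') ∉ ⁅ r' ⁆
      tail∉ t∈ = n≮n _ (subst (λ z → rank z < rank r') (x∈⁅y⁆⇒x≡y r' t∈) (rank-decreases r'≢r))
      parent-enters-r' : parent r' ∈ δin D ⊤ ⁅ r' ⁆
      parent-enters-r' = ∈δin⁺ (subst (_∈ ⁅ r' ⁆) (sym (parent-enters r'≢r)) (x∈⁅x⁆ r')) ∈⊤ tail∉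

    isTight : IsTight D L arcs
    isTight = ((connected , acyclic) , indegree≤1)
            , (λ G∈ → ∣entering∣≤1 λ e e' → proj₂ (tight G∈ e) e')
            , λ r' G∈ root r'∈G → Empty⇒∣p∣≡0 λ (a , a∈) →
                proj₁ (tight G∈ (proj₂ (∈arcs∩δin⁻ a∈))) (subst (_∈ _) (root-unique root) r'∈G)

CutCondition : ∀ {n} → Digraph n → List (Subset n) → Set
CutCondition {n} D L = ∀ {F} → F ∈ₗ L → ∀ (Z₁ Z₂ : Subset n) → Z₁ ⊆ F → Z₂ ⊆ F →
  Nonempty Z₁ → Nonempty Z₂ → Z₁ ∩ Z₂ ≡ ⊥ → f D L F Z₁ + f D L F Z₂ ≥ 1

module Construction {n} (D : Digraph n) (L : List (Subset n)) (laminar : Laminar L)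
  (cut-condition : CutCondition D L) (a₀ : Fin (m D)) where

  open import Data.List.Membership.DecPropositional (≡-dec {n = n} Bool._≟_)
    using () renaming (_∈?_ to _∈ₗ?_)

  Arc : Set
  Arc = Fin (m D)

  record Shield (F Z : Subset n) (a : Arc) : Set where
    field
      {G}    : Subset n
      G∈L    : G ∈ₗ L
      G⊆F    : G ⊆ F
      meets  : Nonempty (G ∩ Z)
      leaves : a ∈ δout D F G

  -- The constructive form of f_{D[F],L[F]}(Z) = 0.
  Shielded : Subset n → Subset n → Set
  Shielded F Z = ∀ {a} → a ∈ δin D F Z → Shield F Z a

  Shielded⇒f≡0 : ∀ {F Z} → Shielded F Z → f D L F Z ≡ 0
  Shielded⇒f≡0 {F} {Z} shielded = Empty⇒∣p∣≡0 {p = M D L F Z} λ (a , a∈M) →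
    let open Shield (shielded (p─q⊆p (δin D F Z) _ a∈M))
        G∈LZ = ∈-filter⁺ (λ G → (G ⊆? F) ×-dec nonempty? (G ∩ Z)) G∈L (G⊆F , meets)
    in x∈p─q⇒x∉q (δin D F Z) _ a∈M (x∈⋃⁺ (∈-map⁺ (δout D F) G∈LZ) leaves)

  shielded-sets-meet : ∀ {F Z₁ Z₂} → F ∈ₗ L → Z₁ ⊆ F → Z₂ ⊆ F → Nonempty Z₁ → Nonempty Z₂ →
                       Shielded F Z₁ → Shielded F Z₂ → Nonempty (Z₁ ∩ Z₂)
  shielded-sets-meet {F} {Z₁} {Z₂} F∈L Z₁⊆F Z₂⊆F ne₁ ne₂ sh₁ sh₂ with nonempty? (Z₁ ∩ Z₂)
  ... | yes meet = meet
  ... | no  ∅ with () ← subst (1 ≤_) (cong₂ _+_ (Shielded⇒f≡0 sh₁) (Shielded⇒f≡0 sh₂))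
                          (cut-condition F∈L Z₁ Z₂ Z₁⊆F Z₂⊆F ne₁ ne₂ (Empty-unique ∅))

  Closed : Subset n → Subset n → Set
  Closed F X = ∀ {G} → G ∈ₗ L → G ⊂ F → ∀ {x} → x ∈ G → x ∈ X → G ⊆ X

  -- An L[F]-tight arborescence of D[X] rooted at r, for X ⊆ F not cutting any
  -- proper member of L[F].  Outside X ∖ {r} the parent arc is junk.
  record Tree (F X : Subset n) (r : Fin n) : Set where
    field
      parent      : Fin n → Arc
      rank        : Fin n → ℕ
      height      : ℕ
      root∈       : r ∈ X
      ⊆F          : X ⊆ F
      closed      : Closed F X
      parent-arc  : ∀ {v} → v ∈ X → v ≢ r →
                    head D (parent v) ≡ v × tail D (parent v) ∈ X × rank (tail D (parent v)) < rank v
      rank<height : ∀ {v} → v ∈ X → rank v < height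
      tight       : ∀ {G} → G ∈ₗ L → G ⊆ X → TightAt D r parent G

  record Certificate (F R : Subset n) : Set where
    field
      R⊆F      : R ⊆ F
      nonempty : Nonempty R
      shielded : Shielded F R
      tree     : ∀ {r} → r ∈ R → Tree F F r

  singleton-certificate : ∀ w → Certificate ⁅ w ⁆ ⁅ w ⁆
  singleton-certificate w = record
    { R⊆F      = λ x∈ → x∈
    ; nonempty = w , x∈⁅x⁆ w
    ; shielded = λ a∈ → let _ , t∈ , t∉ = ∈δin⁻ D {⁅ w ⁆} {⁅ w ⁆} a∈ in ⊥-elim (t∉ t∈)
    ; tree     = λ r∈ → record
      { parent      = λ _ → a₀
      ; rank        = λ _ → 0
      ; height      = 1
      ; root∈       = r∈
      ; ⊆F          = λ x∈ → x∈
      ; closed      = λ _ G⊂ _ _ → proj₁ G⊂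
      ; parent-arc  = λ v∈ v≢r → ⊥-elim (v≢r (same v∈ r∈))
      ; rank<height = λ _ → s≤s z≤n
      ; tight       = λ _ G⊆ (v∈ , v≢r , _) → ⊥-elim (v≢r (same (G⊆ v∈) r∈))
      }
    }
    where
    same : ∀ {x y} → x ∈ ⁅ w ⁆ → y ∈ ⁅ w ⁆ → x ≡ y
    same x∈ y∈ = trans (x∈⁅y⁆⇒x≡y w x∈) (sym (x∈⁅y⁆⇒x≡y w y∈))

  SmallerMember : Subset n → Subset n → Set
  SmallerMember F G = G ∈ₗ L × Nonempty G × ∣ G ∣ < ∣ F ∣

  module InductionStep {F : Subset n} (F∈L : F ∈ₗ L)
    (IH : ∀ {G} → SmallerMember F G → Σ[ R ∈ Subset n ] Certificate G R) where

    -- Computed from the set G alone, so that vertices with the same child get the same roots.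
    rootsOf : Subset n → Subset n
    rootsOf G with (G ∈ₗ? L) ×-dec nonempty? G ×-dec (∣ G ∣ <? ∣ F ∣)
    ... | yes smaller = proj₁ (IH smaller)
    ... | no  _       = G

    rootsOf-certifies : ∀ {G} → Certificate G G ⊎ SmallerMember F G → Certificate G (rootsOf G)
    rootsOf-certifies {G} c with (G ∈ₗ? L) ×-dec nonempty? G ×-dec (∣ G ∣ <? ∣ F ∣) | c
    ... | yes smaller | _       = proj₂ (IH smaller)
    ... | no  _       | inj₁ c' = c'
    ... | no  ¬s      | inj₂ s  = ⊥-elim (¬s s)

    ProperMember : Subset n → Set
    ProperMember G = G ∈ₗ L × G ⊂ F

    ChildKind : Fin n → Subset n → Set
    ChildKind w C = C ≡ ⁅ w ⁆ ⊎ ProperMember C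

    nested : ∀ {w C G x} → ChildKind w C → G ∈ₗ L → x ∈ G → x ∈ C → C ⊆ G ⊎ G ⊆ C
    nested {w} {G = G} (inj₁ refl) _ x∈G x∈C =
      inj₁ λ y∈C → subst (_∈ G) (trans (x∈⁅y⁆⇒x≡y w x∈C) (sym (x∈⁅y⁆⇒x≡y w y∈C))) x∈G
    nested {x = x} (inj₂ (C∈L , _)) G∈L x∈G x∈C with laminar G∈L C∈L
    ... | inj₁ G⊆C          = inj₂ G⊆C
    ... | inj₂ (inj₁ C⊆G)   = inj₁ C⊆G
    ... | inj₂ (inj₂ G∩C≡⊥) = ⊥-elim (∉⊥ (subst (x ∈_) G∩C≡⊥ (x∈p∩q⁺ (x∈G , x∈C))))

    -- By laminarity the proper members of L[F] containing w form a chain.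
    enlarge : Fin n → Subset n → Subset n → Subset n
    enlarge w G C with (G ⊂? F ×-dec w ∈? G) ×-dec C ⊆? G
    ... | yes _ = G
    ... | no  _ = C

    record ChildOver (w : Fin n) (Gs : List (Subset n)) (C : Subset n) : Set where
      field
        w∈C     : w ∈ C
        kind    : ChildKind w C
        maximal : ∀ {G} → G ∈ₗ Gs → G ⊂ F → w ∈ G → G ⊆ C

    foldr-enlarge : ∀ w Gs → (∀ {G} → G ∈ₗ Gs → G ∈ₗ L) → ChildOver w Gs (foldr (enlarge w) ⁅ w ⁆ Gs)
    foldr-enlarge w [] _ = record { w∈C = x∈⁅x⁆ w ; kind = inj₁ refl ; maximal = λ () }
    foldr-enlarge w (G ∷ Gs) Gs⊆L with foldr-enlarge w Gs (λ G∈ → Gs⊆L (thereₗ G∈))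
    ... | ih with (G ⊂? F ×-dec w ∈? G) ×-dec foldr (enlarge w) ⁅ w ⁆ Gs ⊆? G
    ... | yes ((G⊂F , w∈G) , C⊆G) = record
      { w∈C     = w∈G
      ; kind    = inj₂ (Gs⊆L (hereₗ refl) , G⊂F)
      ; maximal = λ { (hereₗ refl) _ _ y∈ → y∈
                    ; (thereₗ H∈) H⊂F w∈H y∈ → C⊆G (ChildOver.maximal ih H∈ H⊂F w∈H y∈) }
      }
    ... | no ¬larger = record { w∈C = w∈C ; kind = kind ; maximal = maximal′ }
      where
      open ChildOver ih
      maximal′ : ∀ {H} → H ∈ₗ G ∷ Gs → H ⊂ F → w ∈ H → H ⊆ foldr (enlarge w) ⁅ w ⁆ Gs
      maximal′ (hereₗ refl) G⊂F w∈G with nested kind (Gs⊆L (hereₗ refl)) w∈G w∈C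
      ... | inj₁ C⊆G = ⊥-elim (¬larger ((G⊂F , w∈G) , C⊆G))
      ... | inj₂ G⊆C = G⊆C
      maximal′ (thereₗ H∈) = maximal H∈

    -- The largest proper member of L[F] containing w, or ⁅ w ⁆; these sets partition F.
    child : Fin n → Subset n
    child w = foldr (enlarge w) ⁅ w ⁆ L

    module _ (w : Fin n) where
      open ChildOver (foldr-enlarge w L (λ G∈ → G∈)) public
        renaming (w∈C to w∈child; kind to child-kind; maximal to child-maximal)

    child⊆F : ∀ {w} → w ∈ F → child w ⊆ F
    child⊆F {w} w∈F with child w | child-kind w
    ... | _ | inj₁ refl      = λ x∈ → subst (_∈ F) (sym (x∈⁅y⁆⇒x≡y w x∈)) w∈F
    ... | _ | inj₂ (_ , C⊂F) = proj₁ C⊂F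

    child-closed : ∀ w → Closed F (child w)
    child-closed w G∈L G⊂F x∈G x∈C with nested (child-kind w) G∈L x∈G x∈C
    ... | inj₁ C⊆G = child-maximal w G∈L G⊂F (C⊆G (w∈child w))
    ... | inj₂ G⊆C = G⊆C

    child⊆closed : ∀ {X w x} → Closed F X → x ∈ child w → x ∈ X → child w ⊆ X
    child⊆closed {X} {w} closed x∈C x∈X with child w | child-kind w
    ... | _ | inj₁ refl = λ y∈ → subst (_∈ X) (trans (x∈⁅y⁆⇒x≡y w x∈C) (sym (x∈⁅y⁆⇒x≡y w y∈))) x∈X
    ... | _ | inj₂ (C∈L , C⊂F) = closed C∈L C⊂F x∈C x∈X

    child-disjoint : ∀ {X w x} → Closed F X → w ∉ X → x ∈ child w → x ∉ X
    child-disjoint {w = w} closed w∉X x∈C x∈X = w∉X (child⊆closed closed x∈C x∈X (w∈child w))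

    child-≡ : ∀ {w x} → x ∈ child w → child x ≡ child w
    child-≡ {w} {x} x∈C = ⊆-antisym (child⊆closed (child-closed w) (w∈child x) x∈C)
                                     (child⊆closed (child-closed x) x∈C (w∈child x))

    roots : Fin n → Subset n
    roots w = rootsOf (child w)

    child-certificate : ∀ w → Certificate (child w) (roots w)
    child-certificate w = rootsOf-certifies (kind⇒ (child-kind w))
      where
      kind⇒ : ChildKind w (child w) → Certificate (child w) (child w) ⊎ SmallerMember F (child w)
      kind⇒ (inj₁ C≡⁅w⁆)      = inj₁ (subst (λ C → Certificate C C) (sym C≡⁅w⁆) (singleton-certificate w))
      kind⇒ (inj₂ (C∈L , C⊂F)) = inj₂ (C∈L , (w , w∈child w) , p⊂q⇒∣p∣<∣q∣ C⊂F)

    module _ (w : Fin n) where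
      open Certificate (child-certificate w) public
        renaming (R⊆F to roots⊆child; nonempty to roots-nonempty; shielded to roots-shielded;
                  tree to child-tree)

    roots-≡ : ∀ {w x} → x ∈ child w → roots x ≡ roots w
    roots-≡ x∈C = cong rootsOf (child-≡ x∈C)

    -- Z is a union of root sets of children.
    record Admissible (Z : Subset n) : Set where
      field
        ⊆F        : Z ⊆ F
        ⊆roots    : ∀ {w} → w ∈ Z → w ∈ roots w
        saturated : ∀ {w x} → w ∈ Z → x ∈ roots w → x ∈ Z

      meets-child⇒roots⊆ : ∀ {w x y} → x ∈ child w → x ∈ Z → y ∈ roots w → y ∈ Z
      meets-child⇒roots⊆ {y = y} x∈C x∈Z y∈R = saturated x∈Z (subst (y ∈_) (sym (roots-≡ x∈C)) y∈R)

    shield-inside-child : ∀ {Z a} → Admissible Z → head D a ∈ Z → tail D a ∈ child (head D a) →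
                          tail D a ∉ Z → Shield F Z a
    shield-inside-child {Z} {a} adm h∈Z t∈C t∉Z = record
      { G∈L    = S.G∈L
      ; G⊆F    = λ x∈G → child⊆F (⊆F h∈Z) (S.G⊆F x∈G)
      ; meets  = y , x∈p∩q⁺ (y∈G , saturated h∈Z y∈R)
      ; leaves = ∈δout⁺ D t∈G (⊆F h∈Z) h∉G
      }
      where
      open Admissible adm
      module S = Shield (roots-shielded (head D a)
                          (∈δin⁺ D (⊆roots h∈Z) t∈C (λ t∈R → t∉Z (saturated h∈Z t∈R))))
      y = proj₁ S.meets
      y∈G = proj₁ (x∈p∩q⁻ S.G _ (proj₂ S.meets))
      y∈R = proj₂ (x∈p∩q⁻ S.G _ (proj₂ S.meets))
      t∈G = proj₁ (∈δout⁻ D {child (head D a)} {S.G} S.leaves)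
      h∉G = proj₂ (proj₂ (∈δout⁻ D {child (head D a)} {S.G} S.leaves))

    shield-by-child : ∀ {Z a y} → head D a ∈ F → tail D a ∉ child (head D a) →
                      y ∈ roots (tail D a) → y ∈ Z → tail D a ∉ Z → Shield F Z a
    shield-by-child {Z} {a} {y} h∈F t∉C y∈R y∈Z t∉Z with child-kind (tail D a)
    ... | inj₁ C≡⁅t⁆ =
      ⊥-elim (t∉Z (subst (_∈ Z) (x∈⁅y⁆⇒x≡y _ (subst (y ∈_) C≡⁅t⁆ (roots⊆child _ y∈R))) y∈Z))
    ... | inj₂ (C∈L , C⊂F) = record
      { G∈L    = C∈L
      ; G⊆F    = proj₁ C⊂F
      ; meets  = y , x∈p∩q⁺ (roots⊆child _ y∈R , y∈Z)
      ; leaves = ∈δout⁺ D (w∈child (tail D a)) h∈F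
                   (λ h∈C → t∉C (subst (tail D a ∈_) (sym (child-≡ h∈C)) (w∈child (tail D a))))
      }

    -- Were a root of the tail's child outside Z, so would be the tail; the shield of a
    -- is then a proper member containing the tail, hence inside its child, and it meets Z.
    tail-roots⊆ : ∀ {Z a y} → Admissible Z → Shielded F Z → head D a ∈ Z → tail D a ∈ F →
                  y ∈ roots (tail D a) → y ∈ Z
    tail-roots⊆ {Z} {a} {y} adm shielded h∈Z t∈F y∈R with y ∈? Z
    ... | yes y∈Z = y∈Z
    ... | no  y∉Z = ⊥-elim (y∉Z (meets-child⇒roots⊆ (G⊆child z∈G) z∈Z y∈R))
      where
      open Admissible adm
      module S = Shield (shielded (∈δin⁺ D h∈Z t∈F (λ t∈Z → y∉Z (saturated t∈Z y∈R))))
      z∈G = proj₁ (x∈p∩q⁻ S.G Z (proj₂ S.meets))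
      z∈Z = proj₂ (x∈p∩q⁻ S.G Z (proj₂ S.meets))
      t∈G = proj₁ (∈δout⁻ D {F} {S.G} S.leaves)
      G⊂F : S.G ⊂ F
      G⊂F = S.G⊆F , head D a , ⊆F h∈Z , proj₂ (proj₂ (∈δout⁻ D {F} {S.G} S.leaves))
      G⊆child : S.G ⊆ child (tail D a)
      G⊆child = child-closed (tail D a) S.G∈L G⊂F t∈G (w∈child (tail D a))

    ∩-admissible : ∀ {Z₁ Z₂} → Admissible Z₁ → Admissible Z₂ → Admissible (Z₁ ∩ Z₂)
    ∩-admissible {Z₁} {Z₂} adm₁ adm₂ = record
      { ⊆F        = λ x∈ → A₁.⊆F (proj₁ (x∈p∩q⁻ Z₁ Z₂ x∈))
      ; ⊆roots    = λ x∈ → A₁.⊆roots (proj₁ (x∈p∩q⁻ Z₁ Z₂ x∈))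
      ; saturated = λ w∈ x∈R → x∈p∩q⁺ ( A₁.saturated (proj₁ (x∈p∩q⁻ Z₁ Z₂ w∈)) x∈R
                                       , A₂.saturated (proj₂ (x∈p∩q⁻ Z₁ Z₂ w∈)) x∈R)
      }
      where
      module A₁ = Admissible adm₁
      module A₂ = Admissible adm₂

    ∩-shielded : ∀ {Z₁ Z₂} → Admissible Z₁ → Admissible Z₂ → Shielded F Z₁ → Shielded F Z₂ →
                 Shielded F (Z₁ ∩ Z₂)
    ∩-shielded {Z₁} {Z₂} adm₁ adm₂ sh₁ sh₂ {a} a∈
      with ∈δin⁻ D {F} {Z₁ ∩ Z₂} a∈ | tail D a ∈? child (head D a)
    ... | h∈Z , _ , t∉Z | yes t∈C = shield-inside-child (∩-admissible adm₁ adm₂) h∈Z t∈C t∉Z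
    ... | h∈Z , t∈F , t∉Z | no t∉C =
      shield-by-child (Admissible.⊆F adm₁ h∈Z₁) t∉C y∈R
        (x∈p∩q⁺ (tail-roots⊆ adm₁ sh₁ h∈Z₁ t∈F y∈R , tail-roots⊆ adm₂ sh₂ h∈Z₂ t∈F y∈R)) t∉Z
      where
      h∈Z₁ = proj₁ (x∈p∩q⁻ Z₁ Z₂ h∈Z)
      h∈Z₂ = proj₂ (x∈p∩q⁻ Z₁ Z₂ h∈Z)
      y∈R = proj₂ (roots-nonempty (tail D a))

    Extends : Subset n → Arc → Set
    Extends X a = tail D a ∈ X × head D a ∈ F × head D a ∉ X × head D a ∈ roots (head D a)

    extends? : ∀ X → Decidable (Extends X)
    extends? X a = (tail D a ∈? X) ×-dec (head D a ∈? F) ×-dec ¬? (head D a ∈? X)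
                   ×-dec (head D a ∈? roots (head D a))

    OutsideRoot : Subset n → Fin n → Set
    OutsideRoot X w = w ∈ F × w ∉ X × w ∈ roots w

    outside-root? : ∀ X → Decidable (OutsideRoot X)
    outside-root? X w = (w ∈? F) ×-dec ¬? (w ∈? X) ×-dec (w ∈? roots w)

    rootsOutside : Subset n → Subset n
    rootsOutside X = ⟦ outside-root? X ⟧

    ∈rootsOutside⁻ : ∀ {X w} → w ∈ rootsOutside X → OutsideRoot X w
    ∈rootsOutside⁻ {X} = ∈⟦⟧⁻ (outside-root? X)

    roots⊆rootsOutside : ∀ {X u y} → Closed F X → u ∈ F → u ∉ X → y ∈ roots u → y ∈ rootsOutside X
    roots⊆rootsOutside {X} {u} {y} closed u∈F u∉X y∈R = ∈⟦⟧⁺ (outside-root? X)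
      ( child⊆F u∈F (roots⊆child u y∈R)
      , child-disjoint closed u∉X (roots⊆child u y∈R)
      , subst (y ∈_) (sym (roots-≡ (roots⊆child u y∈R))) y∈R)

    rootsOutside-admissible : ∀ {X} → Closed F X → Admissible (rootsOutside X)
    rootsOutside-admissible closed = record
      { ⊆F        = λ w∈ → proj₁ (∈rootsOutside⁻ w∈)
      ; ⊆roots    = λ w∈ → proj₂ (proj₂ (∈rootsOutside⁻ w∈))
      ; saturated = λ w∈ x∈R → let w∈F , w∉X , _ = ∈rootsOutside⁻ w∈
                               in roots⊆rootsOutside closed w∈F w∉X x∈R
      }

    rootsOutside-nonempty : ∀ {X v} → Closed F X → v ∈ F → v ∉ X → Nonempty (rootsOutside X)
    rootsOutside-nonempty {v = v} closed v∈F v∉X =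
      let y , y∈R = roots-nonempty v in y , roots⊆rootsOutside closed v∈F v∉X y∈R

    rootsOutside-shielded : ∀ {X} → Closed F X → (∀ a → ¬ Extends X a) → Shielded F (rootsOutside X)
    rootsOutside-shielded {X} closed stuck {a} a∈
      with ∈δin⁻ D {F} {rootsOutside X} a∈ | tail D a ∈? child (head D a) | tail D a ∈? X
    ... | h∈Z , _ , t∉Z | yes t∈C | _ =
      shield-inside-child (rootsOutside-admissible closed) h∈Z t∈C t∉Z
    ... | h∈Z , _ , _ | no _ | yes t∈X =
      let h∈F , h∉X , h∈R = ∈rootsOutside⁻ h∈Z in ⊥-elim (stuck a (t∈X , h∈F , h∉X , h∈R))
    ... | h∈Z , t∈F , t∉Z | no t∉C | no t∉X =
      let y , y∈R = roots-nonempty (tail D a)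
      in shield-by-child (proj₁ (∈rootsOutside⁻ h∈Z)) t∉C y∈R
           (roots⊆rootsOutside closed t∈F t∉X y∈R) t∉Z

    -- Ranks in the attached child are shifted past the height of T.
    module Attach {X r} (T : Tree F X r) {a} (ext : Extends X a) where
      open Tree T
      v = head D a
      u∈X = proj₁ ext
      v∈F = proj₁ (proj₂ ext)
      v∉X = proj₁ (proj₂ (proj₂ ext))
      C = child v
      module S = Tree (child-tree v (proj₂ (proj₂ (proj₂ ext))))

      C∩X≡∅ : ∀ {x} → x ∈ C → x ∉ X
      C∩X≡∅ = child-disjoint closed v∉X

      X′ : Subset n
      X′ = X ∪ C

      X′⊆F : X′ ⊆ F
      X′⊆F x∈X′ with x∈p∪q⁻ X C x∈X′
      ... | inj₁ x∈X = ⊆F x∈X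
      ... | inj₂ x∈C = child⊆F v∈F x∈C

      parent′ : Fin n → Arc
      parent′ x with x ∈? C | x ≟ v
      ... | yes _ | yes _ = a
      ... | yes _ | no  _ = S.parent x
      ... | no  _ | _     = parent x

      rank′ : Fin n → ℕ
      rank′ x with x ∈? C
      ... | yes _ = height + S.rank x
      ... | no  _ = rank x

      parent′-C : ∀ {x} → x ∈ C → x ≢ v → parent′ x ≡ S.parent x
      parent′-C {x} x∈C x≢v with x ∈? C | x ≟ v
      ... | yes _ | yes x≡v = ⊥-elim (x≢v x≡v)
      ... | yes _ | no  _   = refl
      ... | no x∉C | _      = ⊥-elim (x∉C x∈C)

      parent′-X : ∀ {x} → x ∉ C → parent′ x ≡ parent x
      parent′-X {x} x∉C with x ∈? C
      ... | yes x∈C = ⊥-elim (x∉C x∈C)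
      ... | no  _   = refl

      rank′-C : ∀ {x} → x ∈ C → rank′ x ≡ height + S.rank x
      rank′-C {x} x∈C with x ∈? C
      ... | yes _   = refl
      ... | no x∉C  = ⊥-elim (x∉C x∈C)

      rank′-X : ∀ {x} → x ∉ C → rank′ x ≡ rank x
      rank′-X {x} x∉C with x ∈? C
      ... | yes x∈C = ⊥-elim (x∉C x∈C)
      ... | no  _   = refl

      parent-arc′ : ∀ {x} → x ∈ X′ → x ≢ r → head D (parent′ x) ≡ x × tail D (parent′ x) ∈ X′ ×
                    rank′ (tail D (parent′ x)) < rank′ x
      parent-arc′ {x} x∈X′ x≢r with x ∈? C | x ≟ v
      ... | yes _ | yes refl =
        refl , x∈p∪q⁺ (inj₁ u∈X) ,
        subst (_< height + S.rank v) (sym (rank′-X λ u∈C → C∩X≡∅ u∈C u∈X))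
          (<-≤-trans (rank<height u∈X) (m≤m+n _ _))
      ... | yes x∈C | no x≢v =
        let h≡x , t∈C , rank< = S.parent-arc x∈C x≢v
        in h≡x , x∈p∪q⁺ (inj₂ t∈C) , subst (_< height + S.rank x) (sym (rank′-C t∈C)) (+-monoʳ-< height rank<)
      ... | no x∉C | _ with x∈p∪q⁻ X C x∈X′
      ...   | inj₂ x∈C = ⊥-elim (x∉C x∈C)
      ...   | inj₁ x∈X =
        let h≡x , t∈X , rank< = parent-arc x∈X x≢r
        in h≡x , x∈p∪q⁺ (inj₁ t∈X) , subst (_< rank x) (sym (rank′-X λ t∈C → C∩X≡∅ t∈C t∈X)) rank<

      rank<height′ : ∀ {x} → x ∈ X′ → rank′ x < height + S.height
      rank<height′ {x} x∈X′ with x ∈? C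
      ... | yes x∈C = +-monoʳ-< height (S.rank<height x∈C)
      ... | no x∉C with x∈p∪q⁻ X C x∈X′
      ...   | inj₁ x∈X = <-≤-trans (rank<height x∈X) (m≤m+n _ _)
      ...   | inj₂ x∈C = ⊥-elim (x∉C x∈C)

      entry-inside-C : ∀ {G x} → G ⊆ C → Entry D r parent′ G x → x ≡ v ⊎ Entry D v S.parent G x
      entry-inside-C {G} {x} G⊆C (x∈G , _ , t∉G) = case x ≟ v of λ where
        (yes x≡v) → inj₁ x≡v
        (no  x≢v) → inj₂ (x∈G , x≢v , subst (λ b → tail D b ∉ G) (parent′-C (G⊆C x∈G) x≢v) t∉G)

      tight-inside-C : ∀ {G} → G ∈ₗ L → G ⊆ C → TightAt D r parent′ G
      tight-inside-C {G} G∈L G⊆C e =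
          (λ r∈G → C∩X≡∅ (G⊆C r∈G) root∈)
        , λ e′ → unique (entry-inside-C G⊆C e) (entry-inside-C G⊆C e′) (proj₁ e) (proj₁ e′)
        where
        unique : ∀ {x w} → x ≡ v ⊎ Entry D v S.parent G x → w ≡ v ⊎ Entry D v S.parent G w →
                 x ∈ G → w ∈ G → x ≡ w
        unique (inj₁ x≡v)  (inj₁ w≡v)  _   _   = trans x≡v (sym w≡v)
        unique (inj₁ refl) (inj₂ eʷ)   v∈G _   = ⊥-elim (proj₁ (S.tight G∈L G⊆C eʷ) v∈G)
        unique (inj₂ eˣ)   (inj₁ refl) _   v∈G = ⊥-elim (proj₁ (S.tight G∈L G⊆C eˣ) v∈G)
        unique (inj₂ eˣ)   (inj₂ eʷ)   _   _   = proj₂ (S.tight G∈L G⊆C eˣ) eʷ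

      tight′ : ∀ {G} → G ∈ₗ L → G ⊆ X′ → TightAt D r parent′ G
      tight′ {G} G∈L G⊆X′ with nonempty? (G ∩ C) | F ⊆? G
      ... | yes _ | yes F⊆G = λ (x∈G , x≢r , t∉G) →
        ⊥-elim (t∉G (F⊆G (X′⊆F (proj₁ (proj₂ (parent-arc′ (G⊆X′ x∈G) x≢r))))))
      ... | yes (y , y∈G∩C) | no F⊈G =
        tight-inside-C G∈L (child-closed v G∈L G⊂F (proj₁ (x∈p∩q⁻ G C y∈G∩C)) (proj₂ (x∈p∩q⁻ G C y∈G∩C)))
        where
        G⊂F : G ⊂ F
        G⊂F = (λ x∈G → X′⊆F (G⊆X′ x∈G)) , ⊈⇒∃∉ F⊈G
      ... | no G∩C≡∅ | _ = λ e → let r∉G , unique = tight G∈L G⊆X (entry e) in r∉G , λ e′ → unique (entry e′)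
        where
        x∉C : ∀ {x} → x ∈ G → x ∉ C
        x∉C x∈G x∈C = G∩C≡∅ (_ , x∈p∩q⁺ (x∈G , x∈C))
        G⊆X : G ⊆ X
        G⊆X x∈G with x∈p∪q⁻ X C (G⊆X′ x∈G)
        ... | inj₁ x∈X = x∈X
        ... | inj₂ x∈C = ⊥-elim (x∉C x∈G x∈C)
        entry : ∀ {x} → Entry D r parent′ G x → Entry D r parent G x
        entry (x∈G , x≢r , t∉G) = x∈G , x≢r , subst (λ b → tail D b ∉ G) (parent′-X (x∉C x∈G)) t∉G

      closed′ : Closed F X′
      closed′ G∈L G⊂F x∈G x∈X′ y∈G with x∈p∪q⁻ X C x∈X′
      ... | inj₁ x∈X = x∈p∪q⁺ (inj₁ (closed G∈L G⊂F x∈G x∈X y∈G))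
      ... | inj₂ x∈C = x∈p∪q⁺ (inj₂ (child-closed v G∈L G⊂F x∈G x∈C y∈G))

      tree : Tree F X′ r
      tree = record
        { parent      = parent′
        ; rank        = rank′
        ; height      = height + S.height
        ; root∈       = x∈p∪q⁺ (inj₁ root∈)
        ; ⊆F          = X′⊆F
        ; closed      = closed′
        ; parent-arc  = parent-arc′
        ; rank<height = rank<height′
        ; tight       = tight′
        }

      larger : ∣ X ∣ < ∣ X′ ∣
      larger = p⊂q⇒∣p∣<∣q∣ ((λ x∈X → x∈p∪q⁺ (inj₁ x∈X)) , v , x∈p∪q⁺ (inj₂ (w∈child v)) , v∉X)

    tree-of-child : ∀ {r} → r ∈ F → r ∈ roots r → Tree F (child r) r
    tree-of-child {r} r∈F r∈R = record
      { parent      = S.parent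
      ; rank        = S.rank
      ; height      = S.height
      ; root∈       = S.root∈
      ; ⊆F          = child⊆F r∈F
      ; closed      = child-closed r
      ; parent-arc  = S.parent-arc
      ; rank<height = S.rank<height
      ; tight       = S.tight
      }
      where module S = Tree (child-tree r r∈R)

    record Candidate (Z : Subset n) : Set where
      field
        admissible : Admissible Z
        shielded   : Shielded F Z
        nonempty   : Nonempty Z
      open Admissible admissible public

    Shrinks : Subset n → Set
    Shrinks Z = Σ[ Z′ ∈ Subset n ] Candidate Z′ × ∣ Z′ ∣ < ∣ Z ∣

    stuck⇒shrinks : ∀ {Z X r} → Candidate Z → r ∈ Z → Tree F X r → ¬ F ⊆ X →
                    (∀ a → ¬ Extends X a) → Shrinks Z
    stuck⇒shrinks {Z} {X} {r} cand r∈Z T F⊈X stuck =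
        Z ∩ Z′
      , record { admissible = ∩-admissible admissible adm′
               ; shielded   = ∩-shielded admissible adm′ shielded sh′
               ; nonempty   = shielded-sets-meet F∈L ⊆F (Admissible.⊆F adm′) nonempty ne′ shielded sh′ }
      , p⊂q⇒∣p∣<∣q∣ (p∩q⊆p Z Z′ , r , r∈Z , λ r∈Z∩Z′ → r∉Z′ (proj₂ (x∈p∩q⁻ Z Z′ r∈Z∩Z′)))
      where
      open Candidate cand
      Z′ = rootsOutside X
      adm′ = rootsOutside-admissible (Tree.closed T)
      sh′ = rootsOutside-shielded (Tree.closed T) stuck
      ne′ = let v , v∈F , v∉X = ⊈⇒∃∉ F⊈X in rootsOutside-nonempty (Tree.closed T) v∈F v∉X
      r∉Z′ : r ∉ Z′
      r∉Z′ r∈Z′ = proj₁ (proj₂ (∈rootsOutside⁻ r∈Z′)) (Tree.root∈ T)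

    grow : ∀ {Z X r} → Candidate Z → r ∈ Z → Tree F X r → Acc _<_ (∣ F ∣ ∸ ∣ X ∣) → Tree F F r ⊎ Shrinks Z
    grow {X = X} cand r∈Z T (acc rs) with F ⊆? X
    ... | yes F⊆X = inj₁ (subst (λ Y → Tree F Y _) (⊆-antisym (Tree.⊆F T) F⊆X) T)
    ... | no  F⊈X with any? (extends? X)
    ...   | yes (a , ext) = grow cand r∈Z (Attach.tree T ext)
                              (rs (∸-monoʳ-< (Attach.larger T ext) (p⊆q⇒∣p∣≤∣q∣ (Attach.X′⊆F T ext))))
    ...   | no  ∄ext      = inj₂ (stuck⇒shrinks cand r∈Z T F⊈X λ a ext → ∄ext (a , ext))

    attempt : ∀ {Z} → Candidate Z → ∀ r → (r ∈ Z → Tree F F r) ⊎ Shrinks Z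
    attempt {Z} cand r with r ∈? Z
    ... | no  r∉Z = inj₁ λ r∈Z → ⊥-elim (r∉Z r∈Z)
    ... | yes r∈Z = map₁ (λ T _ → T)
      (grow cand r∈Z (tree-of-child (Candidate.⊆F cand r∈Z) (Candidate.⊆roots cand r∈Z)) (<-wellFounded _))

    certify : ∀ {Z} → Candidate Z → Acc _<_ ∣ Z ∣ → Σ[ R ∈ Subset n ] Certificate F R
    certify {Z} cand (acc rs) with pointwise⊎⇒⊎ (attempt cand)
    ... | inj₁ trees = Z , record { R⊆F = ⊆F ; nonempty = nonempty ; shielded = shielded ; tree = trees _ }
      where open Candidate cand
    ... | inj₂ (Z′ , cand′ , smaller) = certify cand′ (rs smaller)

    certificate : Nonempty F → Σ[ R ∈ Subset n ] Certificate F R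
    certificate (w , w∈F) = certify all-roots (<-wellFounded _)
      where
      closed⊥ : Closed F ⊥
      closed⊥ _ _ _ x∈⊥ = ⊥-elim (∉⊥ x∈⊥)
      all-roots : Candidate (rootsOutside ⊥)
      all-roots = record
        { admissible = rootsOutside-admissible closed⊥
        ; shielded   = rootsOutside-shielded closed⊥ (λ _ ext → ∉⊥ (proj₁ ext))
        ; nonempty   = rootsOutside-nonempty closed⊥ w∈F ∉⊥
        }

  certificate : ∀ {F} → F ∈ₗ L → Nonempty F → Acc _<_ ∣ F ∣ → Σ[ R ∈ Subset n ] Certificate F R
  certificate F∈L F-nonempty (acc rs) =
    InductionStep.certificate F∈L (λ (G∈L , G-nonempty , G<F) → certificate G∈L G-nonempty (rs G<F)) F-nonempty

  tight-arborescence : ∀ {r} → Tree ⊤ ⊤ r → Σ (Subset (m D)) (IsTight D L)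
  tight-arborescence {r} T = arcs , isTight
    where
    open Tree T
    open ParentTree D L r parent rank (λ v≢r → proj₁ (parent-arc ∈⊤ v≢r))
                                      (λ v≢r → proj₂ (proj₂ (parent-arc ∈⊤ v≢r)))
                                      (λ G∈L → tight G∈L (λ _ → ∈⊤))

⁅x⁆∩⁅y⁆≡⊥ : ∀ {k} {x y : Fin k} → x ≢ y → ⁅ x ⁆ ∩ ⁅ y ⁆ ≡ ⊥
⁅x⁆∩⁅y⁆≡⊥ {x = x} {y} x≢y = Empty-unique λ (z , z∈) →
  let z≡x , z≡y = x∈p∩q⁻ ⁅ x ⁆ ⁅ y ⁆ z∈ in x≢y (trans (sym (x∈⁅y⁆⇒x≡y x z≡x)) (x∈⁅y⁆⇒x≡y y z≡y))

lemma4 : (n : ℕ) → 1 ≤ n → (D : Digraph n) → (L : List (Subset n)) →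
    Laminar L → ⊤ ∈ₗ L →
    (∀ {F} → F ∈ₗ L → ∀ (Z₁ Z₂ : Subset n) → Z₁ ⊆ F → Z₂ ⊆ F →
      Nonempty Z₁ → Nonempty Z₂ → Z₁ ∩ Z₂ ≡ ⊥ →
      f D L F Z₁ + f D L F Z₂ ≥ 1) →
    Σ (Subset (m D)) (λ B → IsTight D L B)
lemma4 (suc _) _ D@record { m = suc _ } L laminar ⊤∈L cut-condition =
  tight-arborescence (Certificate.tree certificate⊤ (proj₂ (Certificate.nonempty certificate⊤)))
  where
  open Construction D L laminar cut-condition zero
  certificate⊤ = proj₂ (certificate ⊤∈L (zero , ∈⊤) (<-wellFounded _))
-- Without arcs every f vanishes, so the cut condition on ⊤ leaves room for one vertex only.
lemma4 1 _ D@record { m = zero } L _ _ _ =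
  [] , ((connected , λ ()) , λ _ → z≤n) , (λ _ → z≤n) , λ _ _ _ _ → refl
  where
  connected : ∀ u v → Connected D [] u v
  connected zero zero = here
lemma4 (suc (suc _)) _ D@record { m = zero } L _ ⊤∈L cut-condition
  with () ← subst (1 ≤_) (cong₂ _+_ (Empty⇒∣p∣≡0 {p = M D L ⊤ ⁅ zero ⁆} λ { (() , _) })
                                    (Empty⇒∣p∣≡0 {p = M D L ⊤ ⁅ suc zero ⁆} λ { (() , _) }))
              (cut-condition ⊤∈L ⁅ zero ⁆ ⁅ suc zero ⁆ (λ _ → ∈⊤) (λ _ → ∈⊤)
                 (zero , x∈⁅x⁆ zero) (suc zero , x∈⁅x⁆ (suc zero)) (⁅x⁆∩⁅y⁆≡⊥ {x = zero} {suc zero} λ ()))
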